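{- For every integer $n\ge 3$, $\kappa_2(Q_n^3)\ge 6n-7$.
   Context: The $3$-ary $n$-cube $Q_n^3$ is the graph whose vertices are the strings $x_1x_2\cdots x_n$ with each $x_i\in\{0,1,2\}$, two vertices being adjacent iff they differ in exactly one coordinate (equivalently, iff their Lee distance $D_L(x,y)=\sum_{i}\min((x_i-y_i)\bmod 3,\,3-((x_i-y_i)\bmod 3))$ equals $1$). For a graph $G$ and integer $h\ge 0$, a vertex set $S\subseteq V(G)$ is an $h$-extra vertex-cut if $G-S$ is disconnected and every component of $G-S$ has more than $h$ vertices; $\kappa_h(G)$ is the minimum cardinality of an $h$-extra vertex-cut. -}

module Defs where

open import Data.Nat using (ℕ; _<_; _≥_; _*_; _∸_)
open import Data.Fin using (Fin)
open import Data.Vec using (Vec; lookup)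
open import Data.List using (List; length)
open import Data.List.Membership.Propositional using (_∈_; _∉_)
open import Data.List.Relation.Unary.All using (All)
open import Data.List.Relation.Unary.Unique.Propositional using (Unique)
open import Data.Product using (Σ; ∃; _×_; _,_)
open import Relation.Binary.PropositionalEquality using (_≡_; _≢_)
open import Relation.Nullary using (¬_)
open import Level using (Level; suc; _⊔_)

record Graph : Set₁ where
  field
    Vertex : Set
    Adj    : Vertex → Vertex → Set
open Graph public

Q3 : ℕ → Graph
Q3 n = record
  { Vertex = Vec (Fin 3) n
  ; Adj    = λ x y → Σ (Fin n) λ i →
                lookup x i ≢ lookup y i × (∀ j → j ≢ i → lookup x j ≡ lookup y j)
  }

module _ (G : Graph) where

  data Reach (S : List (Vertex G)) : Vertex G → Vertex G → Set where
    here : ∀ {u} → u ∉ S → Reach S u u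
    step : ∀ {u v w} → u ∉ S → Adj G u v → Reach S v w → Reach S u w

  Disconnected : List (Vertex G) → Set
  Disconnected S = ∃ λ u → ∃ λ v → u ∉ S × v ∉ S × ¬ Reach S u v

  ComponentLarger : ℕ → List (Vertex G) → Vertex G → Set
  ComponentLarger h S u =
    ∃ λ (C : List (Vertex G)) → Unique C × h < length C × All (Reach S u) C

  IsExtraCut : ℕ → List (Vertex G) → Set
  IsExtraCut h S =
    Unique S × Disconnected S × (∀ u → u ∉ S → ComponentLarger h S u)

-- Let S be a 2-extra cut of Q_n^3 and u, v vertices in different components of Q_n^3 − S. The
-- component A of u and the set B of all other vertices outside S are non-adjacent, have at least
-- three vertices each, and every vertex in neither of them lies in S. So it suffices to show that
-- a set separating two sets of at least 3 vertices has at least 6n − 7 vertices. This is proved by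
-- induction on n, together with the bounds 2n and 4n − 3 for sides of at least 1 and 2 vertices.
-- The first coordinate slices Q_{n+1}^3 into three copies of Q_n^3, to which the induction
-- hypothesis applies, and a vertex of A in one slice and a vertex of B in another cannot have
-- the same last n coordinates, since they would be adjacent. A case analysis on which slices
-- meet A and B then gives the bounds for n + 1 from the sizes of the traces and 3^n alone.
module Submission where

open import Defs
open import Data.Nat using (ℕ; _≤_; _*_; _∸_)
open import Data.List using (List; length)

open import Data.Bool using (Bool; true; false; T; not; _∨_; _∧_)
open import Data.Bool.ListAction using (any)
open import Data.Bool.Properties using (T?; T-∨; T-∧)
open import Data.Empty using (⊥; ⊥-elim)
open import Data.Fin using (Fin; zero; suc)
open import Data.Fin.Patterns using (0F; 1F; 2F)
open import Data.Fin.Properties using (any?; all?) renaming (_≟_ to _≟ᶠ_)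
open import Data.List using ([]; _∷_; _++_; map; filterᵇ)
open import Data.List.Membership.Propositional using (_∈_; _∉_; lose)
open import Data.List.Membership.Propositional.Properties
  using (∈-∃++; ∈-++⁻; ∈-++⁺ˡ; ∈-++⁺ʳ; ∈-map⁺; ∈-map⁻; ∈-filter⁺; ∈-filter⁻)
open import Data.List.Properties using (filter-++; length-++; length-++-sucʳ; length-map; length-filter)
open import Data.List.Relation.Binary.Disjoint.Propositional using (Disjoint)
open import Data.List.Relation.Binary.Subset.Propositional using (_⊆_)
import Data.List.Relation.Unary.All as All
open import Data.List.Relation.Unary.Any using (here; there; satisfied)
open import Data.List.Relation.Unary.Any.Properties using (any⁺; any⁻)
open import Data.List.Relation.Unary.Unique.Propositional using (Unique)
open import Data.List.Relation.Unary.Unique.Propositional.Properties using (++⁺; map⁺; filter⁺)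
open import Data.Nat using (zero; suc; _+_; _^_; _<_; z≤n; s≤s; _≤?_)
open import Data.Nat.Properties hiding (_≟_)
open import Algebra.Properties.CommutativeSemigroup +-commutativeSemigroup
  using (x∙yz≈x∙zy; x∙yz≈y∙xz; x∙yz≈z∙xy; x∙yz≈y∙zx; x∙yz≈z∙yx)
open import Data.Nat.Tactic.RingSolver using (solve; solve-∀)
open import Data.Product using (_×_; _,_; proj₁; proj₂; ∃; swap)
open import Data.Sum using (_⊎_; inj₁; inj₂)
open import Data.Vec.Properties using (∷-injectiveˡ; ∷-injectiveʳ; ≡-dec)
open import Function using (_∘_; case_of_)
open import Function.Bundles using (Equivalence)
open import Relation.Binary.Definitions using (DecidableEquality)
open import Relation.Binary.PropositionalEquality
open import Relation.Nullary using (¬_; Dec; yes; no; contradiction)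
open import Relation.Nullary.Decidable
  using (⌊_⌋; ¬?; _×-dec_; _→-dec_; toWitness; fromWitness; toWitnessFalse; fromWitnessFalse)

infixl 6 _⊕_
_⊕_ : ∀ {a b c d} → a ≤ b → c ≤ d → a + c ≤ b + d
_⊕_ = +-mono-≤

-- Linear arithmetic by certificate: sum the hypotheses into x ≤ y, then l ≤ r follows from
-- the ring identity r + x ≡ l + y + slack.
≤-by : ∀ {l r x y} slack → x ≤ y → r + x ≡ l + y + slack → l ≤ r
≤-by {l} {r} {x} {y} slack x≤y eq = +-cancelʳ-≤ y l r (begin
  l + y         ≤⟨ m≤m+n (l + y) slack ⟩
  l + y + slack ≡⟨ sym eq ⟩
  r + x         ≤⟨ +-monoʳ-≤ r x≤y ⟩
  r + y         ∎)
  where open ≤-Reasoning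

-- Beyond dimension 1, every bound on 3^n used below is a linear consequence of this one.
9[1+k]≤3^[2+k] : ∀ k → 9 * suc k ≤ 3 ^ (2 + k)
9[1+k]≤3^[2+k] zero    = ≤-refl
9[1+k]≤3^[2+k] (suc k) = ≤-by (18 * k + 9) (h ⊕ h ⊕ h) (e k (3 ^ (2 + k)))
  where
    h : 9 * suc k ≤ 3 ^ (2 + k)
    h = 9[1+k]≤3^[2+k] k
    e : ∀ k p → 3 * p + (9 * suc k + 9 * suc k + 9 * suc k) ≡ 9 * suc (suc k) + (p + p + p) + (18 * k + 9)
    e = solve-∀

2≤3^n⇒1≤n : ∀ {n} → 2 ≤ 3 ^ n → 1 ≤ n
2≤3^n⇒1≤n {zero}  (s≤s ())
2≤3^n⇒1≤n {suc n} _ = s≤s z≤n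

2n<3^n : ∀ n → 2 * n < 3 ^ n
2n<3^n 0             = ≤-refl
2n<3^n 1             = ≤-refl
2n<3^n (suc (suc k)) = ≤-by (7 * k + 4) (9[1+k]≤3^[2+k] k) (e k (3 ^ (2 + k)))
  where
    e : ∀ k p → p + 9 * suc k ≡ suc (2 * suc (suc k)) + p + (7 * k + 4)
    e = solve-∀

4n≤3^n+1 : ∀ n → 4 * n ≤ 3 ^ n + 1
4n≤3^n+1 0             = z≤n
4n≤3^n+1 1             = ≤-refl
4n≤3^n+1 (suc (suc k)) = ≤-by (5 * k + 2) (9[1+k]≤3^[2+k] k) (e k (3 ^ (2 + k)))
  where
    e : ∀ k p → p + 1 + 9 * suc k ≡ 4 * suc (suc k) + p + (5 * k + 2)
    e = solve-∀

6n≤3^n+3 : ∀ n → 6 * n ≤ 3 ^ n + 3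
6n≤3^n+3 0             = z≤n
6n≤3^n+3 1             = ≤-refl
6n≤3^n+3 (suc (suc k)) = ≤-by (3 * k) (9[1+k]≤3^[2+k] k) (e k (3 ^ (2 + k)))
  where
    e : ∀ k p → p + 3 + 9 * suc k ≡ 6 * suc (suc k) + p + 3 * k
    e = solve-∀

4n≤3^n : ∀ {n} → 2 ≤ n → 4 * n ≤ 3 ^ n
4n≤3^n {suc (suc k)} (s≤s (s≤s _)) = ≤-by (5 * k + 1) (9[1+k]≤3^[2+k] k) (e k (3 ^ (2 + k)))
  where
    e : ∀ k p → p + 9 * suc k ≡ 4 * suc (suc k) + p + (5 * k + 1)
    e = solve-∀

6n≤3^n+2 : ∀ {n} → 3 ≤ n → 6 * n ≤ 3 ^ n + 2
6n≤3^n+2 {suc (suc (suc k))} (s≤s (s≤s (s≤s _))) =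
  ≤-by (3 * k + 2) (9[1+k]≤3^[2+k] (suc k)) (e k (3 ^ (3 + k)))
  where
    e : ∀ k p → p + 2 + 9 * suc (suc k) ≡ 6 * suc (suc (suc k)) + p + (3 * k + 2)
    e = solve-∀

-- The isoperimetric inequalities for a set of s vertices separating sets of a and b vertices in
-- Q_n^3: s ≥ 2n, 4n − 3 and 6n − 7 once both sides have at least 1, 2 and 3 vertices.
record SeparatorBounds (n a b s : ℕ) : Set where
  field
    bound₁ : 1 ≤ a → 1 ≤ b → 2 * n ≤ s
    bound₂ : 2 ≤ a → 2 ≤ b → 4 * n ≤ s + 3
    bound₃ : 3 ≤ a → 3 ≤ b → 6 * n ≤ s + 7
open SeparatorBounds

SeparatorBounds-sym : ∀ {n a b s} → SeparatorBounds n a b s → SeparatorBounds n b a s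
SeparatorBounds-sym B = record
  { bound₁ = λ h₁ h₂ → bound₁ B h₂ h₁
  ; bound₂ = λ h₁ h₂ → bound₂ B h₂ h₁
  ; bound₃ = λ h₁ h₂ → bound₃ B h₂ h₁
  }

SeparatorBounds-mono : ∀ {n a a′ b b′ s s′} → a ≤ a′ → b ≤ b′ → s′ ≤ s →
                       SeparatorBounds n a′ b′ s′ → SeparatorBounds n a b s
SeparatorBounds-mono a≤ b≤ ≤s B = record
  { bound₁ = λ h₁ h₂ → ≤-trans (bound₁ B (≤-trans h₁ a≤) (≤-trans h₂ b≤)) ≤s
  ; bound₂ = λ h₁ h₂ → ≤-trans (bound₂ B (≤-trans h₁ a≤) (≤-trans h₂ b≤)) (+-monoˡ-≤ 3 ≤s)
  ; bound₃ = λ h₁ h₂ → ≤-trans (bound₃ B (≤-trans h₁ a≤) (≤-trans h₂ b≤)) (+-monoˡ-≤ 7 ≤s)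
  }

-- The sizes of the two sides and of the separator within one of the three copies of Q_n^3
-- (with N = 3^n vertices) that make up Q_{n+1}^3.
record Slice (n N : ℕ) : Set where
  constructor slice
  field
    a b s     : ℕ
    partition : a + b + s ≡ N
    bounds    : SeparatorBounds n a b s
open Slice

swap-sides : ∀ {n N} → Slice n N → Slice n N
swap-sides L = slice (b L) (a L) (s L) (trans (cong (_+ s L) (+-comm (b L) (a L))) (partition L))
                     (SeparatorBounds-sym (bounds L))

data Arrangement : Fin 3 → Fin 3 → Fin 3 → Set where
  ⟨012⟩ : Arrangement 0F 1F 2F
  ⟨021⟩ : Arrangement 0F 2F 1F
  ⟨102⟩ : Arrangement 1F 0F 2F
  ⟨120⟩ : Arrangement 1F 2F 0F
  ⟨201⟩ : Arrangement 2F 0F 1F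
  ⟨210⟩ : Arrangement 2F 1F 0F

arrangement-distinct : ∀ {i j k} → Arrangement i j k → i ≢ j × i ≢ k × j ≢ k
arrangement-distinct ⟨012⟩ = (λ ()) , (λ ()) , (λ ())
arrangement-distinct ⟨021⟩ = (λ ()) , (λ ()) , (λ ())
arrangement-distinct ⟨102⟩ = (λ ()) , (λ ()) , (λ ())
arrangement-distinct ⟨120⟩ = (λ ()) , (λ ()) , (λ ())
arrangement-distinct ⟨201⟩ = (λ ()) , (λ ()) , (λ ())
arrangement-distinct ⟨210⟩ = (λ ()) , (λ ()) , (λ ())

sum-arranged : ∀ {i j k} → Arrangement i j k → (f : Fin 3 → ℕ) → f i + (f j + f k) ≡ f 0F + (f 1F + f 2F)
sum-arranged ⟨012⟩ f = refl
sum-arranged ⟨021⟩ f = x∙yz≈x∙zy (f 0F) (f 2F) (f 1F)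
sum-arranged ⟨102⟩ f = x∙yz≈y∙xz (f 1F) (f 0F) (f 2F)
sum-arranged ⟨120⟩ f = x∙yz≈z∙xy (f 1F) (f 2F) (f 0F)
sum-arranged ⟨201⟩ f = x∙yz≈y∙zx (f 2F) (f 0F) (f 1F)
sum-arranged ⟨210⟩ f = x∙yz≈z∙yx (f 2F) (f 1F) (f 0F)

module _ {n N : ℕ} (N≡3^n : N ≡ 3 ^ n) where

  private
    2n<N : 2 * n < N
    2n<N = subst (2 * n <_) (sym N≡3^n) (2n<3^n n)

    4n≤N+1 : 4 * n ≤ N + 1
    4n≤N+1 = subst (λ N → 4 * n ≤ N + 1) (sym N≡3^n) (4n≤3^n+1 n)

    6n≤N+3 : 6 * n ≤ N + 3
    6n≤N+3 = subst (λ N → 6 * n ≤ N + 3) (sym N≡3^n) (6n≤3^n+3 n)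

    4n≤N : 2 ≤ n → 4 * n ≤ N
    4n≤N 2≤n = subst (4 * n ≤_) (sym N≡3^n) (4n≤3^n 2≤n)

    6n≤N+2 : 3 ≤ n → 6 * n ≤ N + 2
    6n≤N+2 3≤n = subst (λ N → 6 * n ≤ N + 2) (sym N≡3^n) (6n≤3^n+2 3≤n)

  bounds-from-2n+2n+2n : ∀ {x y z α β} → 1 ≤ n → 2 * n ≤ x → 2 * n ≤ y → 2 * n ≤ z →
                         SeparatorBounds (suc n) α β (x + (y + z))
  bounds-from-2n+2n+2n {x} {y} {z} 1≤n hx hy hz = record
    { bound₁ = λ _ _ → ≤-by (2 * n) (1≤n ⊕ 1≤n ⊕ hx ⊕ hy ⊕ hz) (solve (n ∷ x ∷ y ∷ z ∷ []))
    ; bound₂ = λ _ _ → ≤-by n (1≤n ⊕ hx ⊕ hy ⊕ hz) (solve (n ∷ x ∷ y ∷ z ∷ []))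
    ; bound₃ = λ _ _ → ≤-by 1 (hx ⊕ hy ⊕ hz) (solve (n ∷ x ∷ y ∷ z ∷ []))
    }

  bounds-from-2n+N : ∀ {x y α β} → 2 ≤ N → 2 * n ≤ x → N ≤ y → SeparatorBounds (suc n) α β (x + y)
  bounds-from-2n+N {x} {y} 2≤N hx hy = record
    { bound₁ = λ _ _ → ≤-by 0 (2≤N ⊕ hx ⊕ hy) (solve (n ∷ N ∷ x ∷ y ∷ []))
    ; bound₂ = λ _ _ → ≤-by 0 (2n<N ⊕ hx ⊕ hy) (solve (n ∷ N ∷ x ∷ y ∷ []))
    ; bound₃ = λ _ _ → ≤-by 0 (4n≤N+1 ⊕ hx ⊕ hy) (solve (n ∷ N ∷ x ∷ y ∷ []))
    }

  bounds-from-N≤α+x : ∀ {x y z α β} → N ≤ α + x → α ≤ y → α ≤ z →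
                      SeparatorBounds (suc n) α β (x + (y + z))
  bounds-from-N≤α+x {x} {y} {z} {α} h hy hz = record
    { bound₁ = λ hα _ → ≤-by 0 (2n<N ⊕ h ⊕ hα ⊕ hy ⊕ hz) (solve (n ∷ N ∷ α ∷ x ∷ y ∷ z ∷ []))
    ; bound₂ = λ hα _ → ≤-by 0 (4n≤N+1 ⊕ h ⊕ hα ⊕ hy ⊕ hz) (solve (n ∷ N ∷ α ∷ x ∷ y ∷ z ∷ []))
    ; bound₃ = λ hα _ → ≤-by 1 (6n≤N+3 ⊕ h ⊕ hα ⊕ hy ⊕ hz) (solve (n ∷ N ∷ α ∷ x ∷ y ∷ z ∷ []))
    }

  TwoSided : Slice n N → Set
  TwoSided L = 1 ≤ a L × 1 ≤ b L

  two-sided⇒2≤N : (L : Slice n N) → TwoSided L → 2 ≤ N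
  two-sided⇒2≤N L (ha , hb) = ≤-trans (ha ⊕ hb) (≤-trans (m≤m+n _ (s L)) (≤-reflexive (partition L)))

  two-sided⇒1≤n : (L : Slice n N) → TwoSided L → 1 ≤ n
  two-sided⇒1≤n L t = 2≤3^n⇒1≤n (subst (2 ≤_) N≡3^n (two-sided⇒2≤N L t))

  two-sided⇒2n≤s : (L : Slice n N) → TwoSided L → 2 * n ≤ s L
  two-sided⇒2n≤s L (ha , hb) = bound₁ (bounds L) ha hb

  a-empty⇒a≤s : (L M : Slice n N) → a M ≡ 0 → a L + b M ≤ N → a L ≤ s M
  a-empty⇒a≤s (slice x _ _ _ _) (slice _ b s P _) refl h =
    ≤-by 0 (h ⊕ ≤-reflexive (sym P)) (solve (N ∷ x ∷ b ∷ s ∷ []))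

  b-empty⇒N≤a+s : (L : Slice n N) → b L ≡ 0 → N ≤ a L + s L
  b-empty⇒N≤a+s (slice a _ s P _) refl = ≤-reflexive (trans (sym P) (cong (_+ s) (+-identityʳ a)))

  a-empty-b-empty⇒N≤s+s : (L M : Slice n N) → a L ≡ 0 → b M ≡ 0 → a M + b L ≤ N → N ≤ s L + s M
  a-empty-b-empty⇒N≤s+s (slice _ b s P _) (slice a′ _ s′ P′ _) refl refl h =
    ≤-by 0 (h ⊕ ≤-reflexive (sym P) ⊕ ≤-reflexive (sym P′)) (solve (N ∷ b ∷ s ∷ a′ ∷ s′ ∷ []))

  bound₃-from-wide-slice : ∀ {x z} (L : Slice n N) → 1 ≤ b L → 2 ≤ a L → a L ≤ z → 2 * n ≤ x →
                           6 * suc n ≤ s L + (x + z) + 7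
  bound₃-from-wide-slice {x} {z} (slice a _ s P B) hb ha hz hx = by-b P B hb
    where
      by-b : ∀ {b} → a + b + s ≡ N → SeparatorBounds n a b s → 1 ≤ b → 6 * suc n ≤ s + (x + z) + 7
      by-b {1} P B _ with ≤-<-connex n 1
      ... | inj₁ n≤1 = ≤-by 1 (bound₁ B (<⇒≤ ha) ≤-refl ⊕ hx ⊕ ha ⊕ hz ⊕ n≤1 ⊕ n≤1)
                              (solve (n ∷ a ∷ s ∷ x ∷ z ∷ []))
      ... | inj₂ 1<n = ≤-by 0 (4n≤N 1<n ⊕ ≤-reflexive (sym P) ⊕ hx ⊕ hz) (solve (n ∷ N ∷ a ∷ s ∷ x ∷ z ∷ []))
      by-b {suc (suc _)} _ B _ =
        ≤-by 0 (bound₂ B ha (s≤s (s≤s z≤n)) ⊕ hx ⊕ ha ⊕ hz) (solve (n ∷ a ∷ s ∷ x ∷ z ∷ []))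

  -- The lemmas above-XYZ below are named after the kinds of their three slices:
  -- T for two-sided, A for a-empty, B for b-empty.
  data Kind (L : Slice n N) : Set where
    two-sided : TwoSided L → Kind L
    a-empty   : a L ≡ 0 → Kind L
    b-empty   : b L ≡ 0 → Kind L

  kind : (L : Slice n N) → Kind L
  kind (slice zero    _       _ _ _) = a-empty refl
  kind (slice (suc _) zero    _ _ _) = b-empty refl
  kind (slice (suc _) (suc _) _ _ _) = two-sided (s≤s z≤n , s≤s z≤n)

  BoundsAbove : Slice n N → Slice n N → Slice n N → Set
  BoundsAbove L₀ L₁ L₂ =
    SeparatorBounds (suc n) (a L₀ + (a L₁ + a L₂)) (b L₀ + (b L₁ + b L₂)) (s L₀ + (s L₁ + s L₂))

  above-TTT : ∀ L₀ L₁ L₂ → TwoSided L₀ → TwoSided L₁ → TwoSided L₂ → BoundsAbove L₀ L₁ L₂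
  above-TTT L₀ L₁ L₂ t₀ t₁ t₂ = bounds-from-2n+2n+2n (two-sided⇒1≤n L₀ t₀)
    (two-sided⇒2n≤s L₀ t₀) (two-sided⇒2n≤s L₁ t₁) (two-sided⇒2n≤s L₂ t₂)

  above-TTA : ∀ L₀ L₁ L₂ → TwoSided L₀ → TwoSided L₁ → a L₂ ≡ 0 → a L₀ + b L₂ ≤ N → a L₁ + b L₂ ≤ N →
              BoundsAbove L₀ L₁ L₂
  above-TTA L₀@(slice a₀ _ s₀ _ _) L₁@(slice a₁ _ s₁ _ _) L₂@(slice _ _ s₂ _ _)
            t₀@(ha₀ , hb₀) t₁@(_ , hb₁) refl c₀₂ c₁₂ = record
    { bound₁ = λ _ _ → ≤-by s₂ (1≤n ⊕ 1≤n ⊕ cut₀ ⊕ cut₁) (solve (n ∷ s₀ ∷ s₁ ∷ s₂ ∷ []))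
    ; bound₂ = λ _ _ → ≤-by 0 (cut₀ ⊕ cut₁ ⊕ ha₀ ⊕ a₀≤s₂) (solve (n ∷ a₀ ∷ s₀ ∷ s₁ ∷ s₂ ∷ []))
    ; bound₃ = λ ha _ → third ha
    }
    where
      1≤n : 1 ≤ n
      1≤n = two-sided⇒1≤n L₀ t₀
      cut₀ : 2 * n ≤ s₀
      cut₀ = two-sided⇒2n≤s L₀ t₀
      cut₁ : 2 * n ≤ s₁
      cut₁ = two-sided⇒2n≤s L₁ t₁
      a₀≤s₂ : a₀ ≤ s₂
      a₀≤s₂ = a-empty⇒a≤s L₀ L₂ refl c₀₂
      a₁≤s₂ : a₁ ≤ s₂
      a₁≤s₂ = a-empty⇒a≤s L₁ L₂ refl c₁₂

      third : 3 ≤ a₀ + (a₁ + 0) → 6 * suc n ≤ s₀ + (s₁ + s₂) + 7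
      third h with 2 ≤? a₀
      ... | yes 2≤a₀ = bound₃-from-wide-slice L₀ hb₀ 2≤a₀ a₀≤s₂ cut₁
      ... | no  2≰a₀ = subst (λ σ → 6 * suc n ≤ σ + 7) (x∙yz≈y∙xz s₁ s₀ s₂)
                             (bound₃-from-wide-slice L₁ hb₁ 2≤a₁ a₁≤s₂ cut₀)
        where
          2≤a₁ : 2 ≤ a₁
          2≤a₁ = ≤-by 0 (h ⊕ ≤-pred (≰⇒> 2≰a₀)) (solve (a₀ ∷ a₁ ∷ []))

  above-TAB : ∀ L₀ L₁ L₂ → TwoSided L₀ → a L₁ ≡ 0 → b L₂ ≡ 0 → a L₂ + b L₁ ≤ N → BoundsAbove L₀ L₁ L₂
  above-TAB L₀ L₁ L₂ t₀ z₁ z₂ c₂₁ = bounds-from-2n+N (two-sided⇒2≤N L₀ t₀) (two-sided⇒2n≤s L₀ t₀)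
    (a-empty-b-empty⇒N≤s+s L₁ L₂ z₁ z₂ c₂₁)

  above-TAA : ∀ L₀ L₁ L₂ → TwoSided L₀ → a L₁ ≡ 0 → a L₂ ≡ 0 → a L₀ + b L₁ ≤ N → a L₀ + b L₂ ≤ N →
              BoundsAbove L₀ L₁ L₂
  above-TAA L₀@(slice a _ s P B) L₁@(slice _ _ s₁ _ _) L₂@(slice _ _ s₂ _ _) (_ , hb) refl refl c₀₁ c₀₂ =
    SeparatorBounds-mono (≤-reflexive (+-identityʳ a)) ≤-refl ≤-refl (record
      { bound₁ = λ ha _ → ≤-by 0 (bound₁ B ha hb ⊕ ha ⊕ ha ⊕ a≤s₁ ⊕ a≤s₂) (solve (n ∷ a ∷ s ∷ s₁ ∷ s₂ ∷ []))
      ; bound₂ = λ ha _ → second P B hb ha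
      ; bound₃ = λ ha _ → third P B hb ha
      })
    where
      a≤s₁ : a ≤ s₁
      a≤s₁ = a-empty⇒a≤s L₀ L₁ refl c₀₁
      a≤s₂ : a ≤ s₂
      a≤s₂ = a-empty⇒a≤s L₀ L₂ refl c₀₂

      second : ∀ {b} → a + b + s ≡ N → SeparatorBounds n a b s → 1 ≤ b → 2 ≤ a →
               4 * suc n ≤ s + (s₁ + s₂) + 3
      second {1} P B _ ha with ≤-<-connex n 1
      ... | inj₁ n≤1 = ≤-by 1 (bound₁ B (<⇒≤ ha) ≤-refl ⊕ ha ⊕ ha ⊕ a≤s₁ ⊕ a≤s₂ ⊕ n≤1 ⊕ n≤1)
                              (solve (n ∷ a ∷ s ∷ s₁ ∷ s₂ ∷ []))
      ... | inj₂ 1<n = ≤-by 0 (4n≤N 1<n ⊕ ≤-reflexive (sym P) ⊕ a≤s₁ ⊕ a≤s₂ ⊕ ha)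
                              (solve (n ∷ N ∷ a ∷ s ∷ s₁ ∷ s₂ ∷ []))
      second {suc (suc _)} P B _ ha =
        ≤-by 0 (bound₂ B ha (s≤s (s≤s z≤n)) ⊕ ha ⊕ ha ⊕ a≤s₁ ⊕ a≤s₂) (solve (n ∷ a ∷ s ∷ s₁ ∷ s₂ ∷ []))

      third : ∀ {b} → a + b + s ≡ N → SeparatorBounds n a b s → 1 ≤ b → 3 ≤ a →
              6 * suc n ≤ s + (s₁ + s₂) + 7
      third {1} P _ _ ha =
        ≤-by 0 (6n≤N+3 ⊕ ≤-reflexive (sym P) ⊕ a≤s₁ ⊕ a≤s₂ ⊕ ha) (solve (n ∷ N ∷ a ∷ s ∷ s₁ ∷ s₂ ∷ []))
      third {2} P B _ ha with ≤-<-connex n 2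
      ... | inj₁ n≤2 = ≤-by 0 (bound₂ B (<⇒≤ ha) ≤-refl ⊕ ha ⊕ ha ⊕ a≤s₁ ⊕ a≤s₂ ⊕ n≤2 ⊕ n≤2)
                              (solve (n ∷ a ∷ s ∷ s₁ ∷ s₂ ∷ []))
      ... | inj₂ 2<n = ≤-by 0 (6n≤N+2 2<n ⊕ ≤-reflexive (sym P) ⊕ a≤s₁ ⊕ a≤s₂ ⊕ ha)
                              (solve (n ∷ N ∷ a ∷ s ∷ s₁ ∷ s₂ ∷ []))
      third {suc (suc (suc _))} P B _ ha =
        ≤-by 0 (bound₃ B ha (s≤s (s≤s (s≤s z≤n))) ⊕ ha ⊕ ha ⊕ a≤s₁ ⊕ a≤s₂) (solve (n ∷ a ∷ s ∷ s₁ ∷ s₂ ∷ []))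

  above-BAA : ∀ L₀ L₁ L₂ → b L₀ ≡ 0 → a L₁ ≡ 0 → a L₂ ≡ 0 → a L₀ + b L₁ ≤ N → a L₀ + b L₂ ≤ N →
              BoundsAbove L₀ L₁ L₂
  above-BAA L₀ L₁@(slice _ _ _ _ _) L₂@(slice _ _ _ _ _) z₀ refl refl c₀₁ c₀₂ =
    SeparatorBounds-mono (≤-reflexive (+-identityʳ (a L₀))) ≤-refl ≤-refl
      (bounds-from-N≤α+x (b-empty⇒N≤a+s L₀ z₀) (a-empty⇒a≤s L₀ L₁ refl c₀₁) (a-empty⇒a≤s L₀ L₂ refl c₀₂))

  above-AAA : ∀ L₀ L₁ L₂ → a L₀ ≡ 0 → a L₁ ≡ 0 → a L₂ ≡ 0 → BoundsAbove L₀ L₁ L₂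
  above-AAA (slice _ _ _ _ _) (slice _ _ _ _ _) (slice _ _ _ _ _) refl refl refl =
    record { bound₁ = λ () ; bound₂ = λ () ; bound₃ = λ () }

  -- Vertices c ∷ x of A and d ∷ x of B with c ≢ d would be adjacent, so the A-part of slice c and
  -- the B-part of slice d lie over disjoint sets of tails x.
  Cross : (Fin 3 → Slice n N) → Set
  Cross L = ∀ {i j} → i ≢ j → a (L i) + b (L j) ≤ N

  swapped-cross : ∀ L → Cross L → Cross (swap-sides ∘ L)
  swapped-cross L cross {i} {j} i≢j = ≤-trans (≤-reflexive (+-comm (b (L i)) (a (L j)))) (cross (≢-sym i≢j))

  module Cases (L : Fin 3 → Slice n N) (cross : Cross L) where

    arranged : ∀ {i j k} → Arrangement i j k →
               BoundsAbove (L i) (L j) (L k) → BoundsAbove (L 0F) (L 1F) (L 2F)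
    arranged p = SeparatorBounds-mono (≤-reflexive (sym (sum-arranged p (a ∘ L))))
                   (≤-reflexive (sym (sum-arranged p (b ∘ L)))) (≤-reflexive (sum-arranged p (s ∘ L)))

    TTA : ∀ {i j k} → Arrangement i j k → TwoSided (L i) → TwoSided (L j) → a (L k) ≡ 0 →
          BoundsAbove (L 0F) (L 1F) (L 2F)
    TTA {i} {j} {k} p tᵢ tⱼ zₖ with _ , i≢k , j≢k ← arrangement-distinct p =
      arranged p (above-TTA (L i) (L j) (L k) tᵢ tⱼ zₖ (cross i≢k) (cross j≢k))

    TAB : ∀ {i j k} → Arrangement i j k → TwoSided (L i) → a (L j) ≡ 0 → b (L k) ≡ 0 →
          BoundsAbove (L 0F) (L 1F) (L 2F)
    TAB {i} {j} {k} p tᵢ zⱼ zₖ with _ , _ , j≢k ← arrangement-distinct p =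
      arranged p (above-TAB (L i) (L j) (L k) tᵢ zⱼ zₖ (cross (≢-sym j≢k)))

    TAA : ∀ {i j k} → Arrangement i j k → TwoSided (L i) → a (L j) ≡ 0 → a (L k) ≡ 0 →
          BoundsAbove (L 0F) (L 1F) (L 2F)
    TAA {i} {j} {k} p tᵢ zⱼ zₖ with i≢j , i≢k , _ ← arrangement-distinct p =
      arranged p (above-TAA (L i) (L j) (L k) tᵢ zⱼ zₖ (cross i≢j) (cross i≢k))

    BAA : ∀ {i j k} → Arrangement i j k → b (L i) ≡ 0 → a (L j) ≡ 0 → a (L k) ≡ 0 →
          BoundsAbove (L 0F) (L 1F) (L 2F)
    BAA {i} {j} {k} p zᵢ zⱼ zₖ with i≢j , i≢k , _ ← arrangement-distinct p =
      arranged p (above-BAA (L i) (L j) (L k) zᵢ zⱼ zₖ (cross i≢j) (cross i≢k))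

  module _ (L : Fin 3 → Slice n N) (cross : Cross L) where
    private
      module C = Cases L cross
      module C′ = Cases (swap-sides ∘ L) (swapped-cross L cross)

    -- The cases with more b-empty than a-empty slices are read off the slices with A and B exchanged.
    bounds-above : BoundsAbove (L 0F) (L 1F) (L 2F)
    bounds-above with kind (L 0F) | kind (L 1F) | kind (L 2F)
    ... | two-sided t₀ | two-sided t₁ | two-sided t₂ = above-TTT (L 0F) (L 1F) (L 2F) t₀ t₁ t₂
    ... | two-sided t₀ | two-sided t₁ | a-empty   z₂ = C.TTA ⟨012⟩ t₀ t₁ z₂
    ... | two-sided t₀ | a-empty   z₁ | two-sided t₂ = C.TTA ⟨021⟩ t₀ t₂ z₁
    ... | a-empty   z₀ | two-sided t₁ | two-sided t₂ = C.TTA ⟨120⟩ t₁ t₂ z₀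
    ... | two-sided t₀ | two-sided t₁ | b-empty   z₂ = SeparatorBounds-sym (C′.TTA ⟨012⟩ (swap t₀) (swap t₁) z₂)
    ... | two-sided t₀ | b-empty   z₁ | two-sided t₂ = SeparatorBounds-sym (C′.TTA ⟨021⟩ (swap t₀) (swap t₂) z₁)
    ... | b-empty   z₀ | two-sided t₁ | two-sided t₂ = SeparatorBounds-sym (C′.TTA ⟨120⟩ (swap t₁) (swap t₂) z₀)
    ... | two-sided t₀ | a-empty   z₁ | a-empty   z₂ = C.TAA ⟨012⟩ t₀ z₁ z₂
    ... | a-empty   z₀ | two-sided t₁ | a-empty   z₂ = C.TAA ⟨102⟩ t₁ z₀ z₂
    ... | a-empty   z₀ | a-empty   z₁ | two-sided t₂ = C.TAA ⟨201⟩ t₂ z₀ z₁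
    ... | two-sided t₀ | b-empty   z₁ | b-empty   z₂ = SeparatorBounds-sym (C′.TAA ⟨012⟩ (swap t₀) z₁ z₂)
    ... | b-empty   z₀ | two-sided t₁ | b-empty   z₂ = SeparatorBounds-sym (C′.TAA ⟨102⟩ (swap t₁) z₀ z₂)
    ... | b-empty   z₀ | b-empty   z₁ | two-sided t₂ = SeparatorBounds-sym (C′.TAA ⟨201⟩ (swap t₂) z₀ z₁)
    ... | two-sided t₀ | a-empty   z₁ | b-empty   z₂ = C.TAB ⟨012⟩ t₀ z₁ z₂
    ... | a-empty   z₀ | two-sided t₁ | b-empty   z₂ = C.TAB ⟨102⟩ t₁ z₀ z₂
    ... | a-empty   z₀ | b-empty   z₁ | two-sided t₂ = C.TAB ⟨201⟩ t₂ z₀ z₁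
    ... | two-sided t₀ | b-empty   z₁ | a-empty   z₂ = SeparatorBounds-sym (C′.TAB ⟨012⟩ (swap t₀) z₁ z₂)
    ... | b-empty   z₀ | two-sided t₁ | a-empty   z₂ = SeparatorBounds-sym (C′.TAB ⟨102⟩ (swap t₁) z₀ z₂)
    ... | b-empty   z₀ | a-empty   z₁ | two-sided t₂ = SeparatorBounds-sym (C′.TAB ⟨201⟩ (swap t₂) z₀ z₁)
    ... | b-empty   z₀ | a-empty   z₁ | a-empty   z₂ = C.BAA ⟨012⟩ z₀ z₁ z₂
    ... | a-empty   z₀ | b-empty   z₁ | a-empty   z₂ = C.BAA ⟨102⟩ z₁ z₀ z₂
    ... | a-empty   z₀ | a-empty   z₁ | b-empty   z₂ = C.BAA ⟨201⟩ z₂ z₀ z₁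
    ... | a-empty   z₀ | b-empty   z₁ | b-empty   z₂ = SeparatorBounds-sym (C′.BAA ⟨012⟩ z₀ z₁ z₂)
    ... | b-empty   z₀ | a-empty   z₁ | b-empty   z₂ = SeparatorBounds-sym (C′.BAA ⟨102⟩ z₁ z₀ z₂)
    ... | b-empty   z₀ | b-empty   z₁ | a-empty   z₂ = SeparatorBounds-sym (C′.BAA ⟨201⟩ z₂ z₀ z₁)
    ... | a-empty   z₀ | a-empty   z₁ | a-empty   z₂ = above-AAA (L 0F) (L 1F) (L 2F) z₀ z₁ z₂
    ... | b-empty   z₀ | b-empty   z₁ | b-empty   z₂ =
      SeparatorBounds-sym (above-AAA (swap-sides (L 0F)) (swap-sides (L 1F)) (swap-sides (L 2F)) z₀ z₁ z₂)

-- Imported only now: their constructors would make the variable lists of the ring solver above ambiguous.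
open import Data.List.Relation.Unary.AllPairs using ([]; _∷_)
open import Data.Vec using ([]; _∷_; lookup)

bounded-sequence-stalls : (f : ℕ → ℕ) (B : ℕ) → (∀ k → f k ≤ B) → ∃ λ j → f (suc j) ≤ f j
bounded-sequence-stalls f B bounded = case climb (suc B) of λ
    { (inj₁ stall) → stall
    ; (inj₂ B<f)   → contradiction (bounded (suc B)) (<⇒≱ B<f)
    }
  where
    climb : ∀ k → (∃ λ j → f (suc j) ≤ f j) ⊎ k ≤ f k
    climb zero = inj₂ z≤n
    climb (suc k) with climb k | f (suc k) ≤? f k
    ... | inj₁ stall | _      = inj₁ stall
    ... | inj₂ _     | yes ≤f = inj₁ (k , ≤f)
    ... | inj₂ k≤fk  | no  ≰f = inj₂ (≤-trans (s≤s k≤fk) (≰⇒> ≰f))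

count : ∀ {A : Set} → (A → Bool) → List A → ℕ
count P xs = length (filterᵇ P xs)

neither : ∀ {A : Set} → (A → Bool) → (A → Bool) → A → Bool
neither P Q x = not (P x ∨ Q x)

count-map : ∀ {A B : Set} P (f : B → A) xs → count P (map f xs) ≡ count (P ∘ f) xs
count-map P f [] = refl
count-map P f (x ∷ xs) with P (f x)
... | true  = cong suc (count-map P f xs)
... | false = count-map P f xs

module _ {A : Set} where

  count-++ : ∀ (P : A → Bool) xs ys → count P (xs ++ ys) ≡ count P xs + count P ys
  count-++ P xs ys = trans (cong length (filter-++ (T? ∘ P) xs ys)) (length-++ (filterᵇ P xs))

  count-partition : ∀ {P Q : A → Bool} → (∀ {x} → T (P x) → T (Q x) → ⊥) → ∀ xs →
                    count P xs + count Q xs + count (neither P Q) xs ≡ length xs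
  count-partition disjoint [] = refl
  count-partition {P} {Q} disjoint (x ∷ xs) with P x in p | Q x in q | count-partition disjoint xs
  ... | true  | true  | _  = ⊥-elim (disjoint (subst T (sym p) _) (subst T (sym q) _))
  ... | true  | false | ih = cong suc ih
  ... | false | true  | ih =
    trans (cong (_+ count (neither P Q) xs) (+-suc (count P xs) (count Q xs))) (cong suc ih)
  ... | false | false | ih = trans (+-suc (count P xs + count Q xs) (count (neither P Q) xs)) (cong suc ih)

  count-disjoint : ∀ {P Q : A → Bool} → (∀ {x} → T (P x) → T (Q x) → ⊥) → ∀ xs →
                   count P xs + count Q xs ≤ length xs
  count-disjoint disjoint xs = ≤-trans (m≤m+n _ _) (≤-reflexive (count-partition disjoint xs))

  count-mono : ∀ {P Q : A → Bool} → (∀ {x} → T (P x) → T (Q x)) → ∀ xs → count P xs ≤ count Q xs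
  count-mono P⊆Q [] = z≤n
  count-mono {P} {Q} P⊆Q (x ∷ xs) with P x in p | Q x in q
  ... | true  | true  = s≤s (count-mono P⊆Q xs)
  ... | true  | false = ⊥-elim (subst T q (P⊆Q (subst T (sym p) _)))
  ... | false | true  = m≤n⇒m≤1+n (count-mono P⊆Q xs)
  ... | false | false = count-mono P⊆Q xs

  count-mono-< : ∀ {P Q : A → Bool} {x xs} → (∀ {x} → T (P x) → T (Q x)) →
                 x ∈ xs → ¬ T (P x) → T (Q x) → count P xs < count Q xs
  count-mono-< {P} {Q} {x} {x ∷ xs} P⊆Q (here refl) ¬Px Qx with P x | Q x
  ... | true  | _     = contradiction _ ¬Px
  ... | false | true  = s≤s (count-mono P⊆Q xs)
  count-mono-< {P} {Q} {_} {y ∷ xs} P⊆Q (there x∈xs) ¬Px Qx with P y in p | Q y in q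
  ... | true  | true  = s≤s (count-mono-< P⊆Q x∈xs ¬Px Qx)
  ... | true  | false = ⊥-elim (subst T q (P⊆Q (subst T (sym p) _)))
  ... | false | true  = m<n⇒m<1+n (count-mono-< P⊆Q x∈xs ¬Px Qx)
  ... | false | false = count-mono-< P⊆Q x∈xs ¬Px Qx

  Unique-⊆⇒length≤ : ∀ {xs ys : List A} → Unique xs → xs ⊆ ys → length xs ≤ length ys
  Unique-⊆⇒length≤ {[]}     _          _     = z≤n
  Unique-⊆⇒length≤ {x ∷ xs} (x∉xs ∷ u) xs⊆ys with ∈-∃++ (xs⊆ys (here refl))
  ... | ys₁ , ys₂ , refl = begin
    suc (length xs)           ≤⟨ s≤s (Unique-⊆⇒length≤ u xs⊆ys₁++ys₂) ⟩
    suc (length (ys₁ ++ ys₂)) ≡⟨ sym (length-++-sucʳ ys₁ x ys₂) ⟩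
    length (ys₁ ++ x ∷ ys₂)   ∎
    where
      open ≤-Reasoning
      xs⊆ys₁++ys₂ : xs ⊆ ys₁ ++ ys₂
      xs⊆ys₁++ys₂ z∈xs with ∈-++⁻ ys₁ (xs⊆ys (there z∈xs))
      ... | inj₁ z∈ys₁         = ∈-++⁺ˡ z∈ys₁
      ... | inj₂ (here refl)   = contradiction refl (All.lookup x∉xs z∈xs)
      ... | inj₂ (there z∈ys₂) = ∈-++⁺ʳ ys₁ z∈ys₂

module _ {G : Graph} {S : List (Vertex G)} where

  Reach-source∉ : ∀ {u v} → Reach G S u v → u ∉ S
  Reach-source∉ (here u∉S)     = u∉S
  Reach-source∉ (step u∉S _ _) = u∉S

  Reach-target∉ : ∀ {u v} → Reach G S u v → v ∉ S
  Reach-target∉ (here v∉S)   = v∉S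
  Reach-target∉ (step _ _ r) = Reach-target∉ r

  Reach-snoc : ∀ {u v w} → Reach G S u v → Adj G v w → w ∉ S → Reach G S u w
  Reach-snoc (here u∉S)       a w∉S = step u∉S a (here w∉S)
  Reach-snoc (step u∉S a′ r)  a w∉S = step u∉S a′ (Reach-snoc r a w∉S)

  Reach-trans : ∀ {u v w} → Reach G S u v → Reach G S v w → Reach G S u w
  Reach-trans (here _)       r′ = r′
  Reach-trans (step u∉S a r) r′ = step u∉S a (Reach-trans r r′)

  Reach-sym : (∀ {x y} → Adj G x y → Adj G y x) → ∀ {u v} → Reach G S u v → Reach G S v u
  Reach-sym adj-sym (here u∉S)     = here u∉S
  Reach-sym adj-sym (step u∉S a r) = Reach-snoc (Reach-sym adj-sym r) (adj-sym a) u∉S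

-- Breadth-first search: the balls around u in G − S grow until they stall, which they must since G
-- is finite, and a stalled ball is closed under adjacency in G − S.
module Reachability (G : Graph) (vertices : List (Vertex G)) (∈-vertices : ∀ x → x ∈ vertices)
                    (_≟_ : DecidableEquality (Vertex G)) (adj? : ∀ x y → Dec (Adj G x y)) where

  open import Data.List.Membership.DecPropositional _≟_ public using (_∈?_)

  module _ (S : List (Vertex G)) {u : Vertex G} (u∉S : u ∉ S) where

    ball : ℕ → Vertex G → Bool
    ball zero    x = ⌊ x ≟ u ⌋
    ball (suc k) x = ball k x ∨ (not ⌊ x ∈? S ⌋ ∧ any (λ y → ball k y ∧ ⌊ adj? y x ⌋) vertices)

    ball⇒Reach : ∀ k {x} → T (ball k x) → Reach G S u x
    ball⇒Reach zero {x} t = subst (Reach G S u) (sym (toWitness {a? = x ≟ u} t)) (here u∉S)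
    ball⇒Reach (suc k) t with Equivalence.to T-∨ t
    ... | inj₁ t′ = ball⇒Reach k t′
    ... | inj₂ t′ with x∉S , frontier ← Equivalence.to T-∧ t′
                  with y , ty ← satisfied (any⁻ _ vertices frontier)
                  with y∈ball , y~x ← Equivalence.to T-∧ ty
      = Reach-snoc (ball⇒Reach k y∈ball) (toWitness y~x) (toWitnessFalse x∉S)

    ball-mono : ∀ k {x} → T (ball k x) → T (ball (suc k) x)
    ball-mono k t = Equivalence.from T-∨ (inj₁ t)

    center∈ball : ∀ k → T (ball k u)
    center∈ball zero    = fromWitness refl
    center∈ball (suc k) = ball-mono k (center∈ball k)

    stalled : ∃ λ r → count (ball (suc r)) vertices ≤ count (ball r) vertices
    stalled = bounded-sequence-stalls (λ k → count (ball k) vertices) (length vertices)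
                (λ k → length-filter (T? ∘ ball k) vertices)

    radius : ℕ
    radius = proj₁ stalled

    closed : ∀ {x y} → T (ball radius y) → Adj G y x → x ∉ S → T (ball radius x)
    closed {x} {y} ty y~x x∉S with T? (ball radius x)
    ... | yes tx = tx
    ... | no ¬tx =
      contradiction (proj₂ stalled) (<⇒≱ (count-mono-< (ball-mono radius) (∈-vertices x) ¬tx grown))
      where
        grown : T (ball (suc radius) x)
        grown = Equivalence.from (T-∨ {ball radius x}) (inj₂ (Equivalence.from (T-∧ {not ⌊ x ∈? S ⌋})
                  (fromWitnessFalse x∉S , any⁺ (λ z → ball radius z ∧ ⌊ adj? z x ⌋)
                    (lose (∈-vertices y) (Equivalence.from (T-∧ {ball radius y}) (ty , fromWitness y~x))))))

    Reach⇒ball : ∀ {x y} → T (ball radius y) → Reach G S y x → T (ball radius x)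
    Reach⇒ball ty (here _)       = ty
    Reach⇒ball ty (step _ y~z r) = Reach⇒ball (closed ty y~z (Reach-source∉ r)) r

  reach? : ∀ S u x → Dec (Reach G S u x)
  reach? S u x with u ∈? S
  ... | yes u∈S = no λ r → Reach-source∉ r u∈S
  ... | no  u∉S with T? (ball S u∉S (radius S u∉S) x)
  ...   | yes t  = yes (ball⇒Reach S u∉S (radius S u∉S) t)
  ...   | no  ¬t = no (¬t ∘ Reach⇒ball S u∉S (center∈ball S u∉S (radius S u∉S)))

vertices : ∀ n → List (Vertex (Q3 n))
vertices zero    = [] ∷ []
vertices (suc n) = map (0F ∷_) (vertices n) ++ map (1F ∷_) (vertices n) ++ map (2F ∷_) (vertices n)

∈-vertices : ∀ {n} (x : Vertex (Q3 n)) → x ∈ vertices n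
∈-vertices []              = here refl
∈-vertices {suc n} (0F ∷ x) = ∈-++⁺ˡ (∈-map⁺ (0F ∷_) (∈-vertices x))
∈-vertices {suc n} (1F ∷ x) = ∈-++⁺ʳ (map (0F ∷_) (vertices n)) (∈-++⁺ˡ (∈-map⁺ (1F ∷_) (∈-vertices x)))
∈-vertices {suc n} (2F ∷ x) =
  ∈-++⁺ʳ (map (0F ∷_) (vertices n)) (∈-++⁺ʳ (map (1F ∷_) (vertices n)) (∈-map⁺ (2F ∷_) (∈-vertices x)))

vertices-unique : ∀ n → Unique (vertices n)
vertices-unique zero    = All.[] ∷ []
vertices-unique (suc n) = ++⁺ (copy 0F) (++⁺ (copy 1F) (copy 2F) (apart (λ ()))) λ (v∈₀ , v∈₁₂) →
  case ∈-++⁻ (map (1F ∷_) (vertices n)) v∈₁₂ of λ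
    { (inj₁ v∈₁) → apart (λ ()) (v∈₀ , v∈₁)
    ; (inj₂ v∈₂) → apart (λ ()) (v∈₀ , v∈₂)
    }
  where
    copy : ∀ c → Unique (map (c ∷_) (vertices n))
    copy c = map⁺ ∷-injectiveʳ (vertices-unique n)
    apart : ∀ {c d} → c ≢ d → Disjoint (map (c ∷_) (vertices n)) (map (d ∷_) (vertices n))
    apart {c} {d} c≢d (v∈c , v∈d) with ∈-map⁻ (c ∷_) v∈c | ∈-map⁻ (d ∷_) v∈d
    ... | _ , _ , refl | _ , _ , eq = c≢d (∷-injectiveˡ eq)

length-vertices : ∀ n → length (vertices n) ≡ 3 ^ n
length-vertices zero    = refl
length-vertices (suc n) = begin
  length (map (0F ∷_) vs ++ map (1F ∷_) vs ++ map (2F ∷_) vs)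
    ≡⟨ length-++ (map (0F ∷_) vs) ⟩
  length (map (0F ∷_) vs) + length (map (1F ∷_) vs ++ map (2F ∷_) vs)
    ≡⟨ cong (length (map (0F ∷_) vs) +_) (length-++ (map (1F ∷_) vs)) ⟩
  length (map (0F ∷_) vs) + (length (map (1F ∷_) vs) + length (map (2F ∷_) vs))
    ≡⟨ cong₂ _+_ (length-map (0F ∷_) vs) (cong₂ _+_ (length-map (1F ∷_) vs) (length-map (2F ∷_) vs)) ⟩
  length vs + (length vs + length vs)
    ≡⟨ cong (λ m → m + (m + m)) (length-vertices n) ⟩
  3 ^ n + (3 ^ n + 3 ^ n)
    ≡⟨ cong (λ m → 3 ^ n + (3 ^ n + m)) (sym (+-identityʳ (3 ^ n))) ⟩
  3 ^ suc n ∎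
  where
    open ≡-Reasoning
    vs = vertices n

count-vertices : ∀ n (P : Vertex (Q3 (suc n)) → Bool) → count P (vertices (suc n)) ≡
  count (P ∘ (0F ∷_)) (vertices n) + (count (P ∘ (1F ∷_)) (vertices n) + count (P ∘ (2F ∷_)) (vertices n))
count-vertices n P = begin
  count P (map (0F ∷_) vs ++ map (1F ∷_) vs ++ map (2F ∷_) vs)
    ≡⟨ count-++ P (map (0F ∷_) vs) _ ⟩
  count P (map (0F ∷_) vs) + count P (map (1F ∷_) vs ++ map (2F ∷_) vs)
    ≡⟨ cong (count P (map (0F ∷_) vs) +_) (count-++ P (map (1F ∷_) vs) _) ⟩
  count P (map (0F ∷_) vs) + (count P (map (1F ∷_) vs) + count P (map (2F ∷_) vs))
    ≡⟨ cong₂ _+_ (count-map P (0F ∷_) vs) (cong₂ _+_ (count-map P (1F ∷_) vs) (count-map P (2F ∷_) vs)) ⟩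
  count (P ∘ (0F ∷_)) vs + (count (P ∘ (1F ∷_)) vs + count (P ∘ (2F ∷_)) vs) ∎
  where
    open ≡-Reasoning
    vs = vertices n

adj? : ∀ {n} (x y : Vertex (Q3 n)) → Dec (Adj (Q3 n) x y)
adj? x y = any? λ i → ¬? (lookup x i ≟ᶠ lookup y i) ×-dec
                      all? λ j → ¬? (j ≟ᶠ i) →-dec (lookup x j ≟ᶠ lookup y j)

adj-sym : ∀ {n} (x y : Vertex (Q3 n)) → Adj (Q3 n) x y → Adj (Q3 n) y x
adj-sym _ _ (i , xᵢ≢yᵢ , agree) = i , xᵢ≢yᵢ ∘ sym , λ j j≢i → sym (agree j j≢i)

adj-head : ∀ {n c d} (x : Vertex (Q3 n)) → c ≢ d → Adj (Q3 (suc n)) (c ∷ x) (d ∷ x)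
adj-head x c≢d = zero , c≢d , λ { zero 0≢0 → contradiction refl 0≢0 ; (suc j) _ → refl }

adj-∷ : ∀ {n} {x y : Vertex (Q3 n)} c → Adj (Q3 n) x y → Adj (Q3 (suc n)) (c ∷ x) (c ∷ y)
adj-∷ c (i , xᵢ≢yᵢ , agree) = suc i , xᵢ≢yᵢ , λ { zero _ → refl ; (suc j) j≢i → agree j (j≢i ∘ cong suc) }

size : ∀ {n} → (Vertex (Q3 n) → Bool) → ℕ
size {n} P = count P (vertices n)

size≤length : ∀ {n S} {P : Vertex (Q3 n) → Bool} → (∀ {x} → T (P x) → x ∈ S) → size P ≤ length S
size≤length {n} {P = P} P⊆S = Unique-⊆⇒length≤ (filter⁺ (T? ∘ P) (vertices-unique n))
                                λ x∈ → P⊆S (proj₂ (∈-filter⁻ (T? ∘ P) {xs = vertices n} x∈))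

larger⇒size : ∀ {n h S w} {P : Vertex (Q3 n) → Bool} → ComponentLarger (Q3 n) h S w →
              (∀ {x} → Reach (Q3 n) S w x → T (P x)) → h < size P
larger⇒size {P = P} (C , C-unique , h<∣C∣ , C-reached) Reach⇒P =
  ≤-trans h<∣C∣ (Unique-⊆⇒length≤ C-unique λ x∈C →
    ∈-filter⁺ (T? ∘ P) (∈-vertices _) (Reach⇒P (All.lookup C-reached x∈C)))

record Separated {n} (A B : Vertex (Q3 n) → Bool) : Set where
  field
    disjoint    : ∀ {x} → T (A x) → T (B x) → ⊥
    nonadjacent : ∀ {x y} → T (A x) → T (B y) → ¬ Adj (Q3 n) x y
open Separated

restrict : ∀ {n} {A B : Vertex (Q3 (suc n)) → Bool} c → Separated A B →
           Separated (A ∘ (c ∷_)) (B ∘ (c ∷_))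
restrict c sep = record
  { disjoint    = disjoint sep
  ; nonadjacent = λ ta tb → nonadjacent sep ta tb ∘ adj-∷ c
  }

separator-bounds : ∀ n {A B : Vertex (Q3 n) → Bool} → Separated A B →
                   SeparatorBounds n (size A) (size B) (size (neither A B))
separator-bounds zero    _ = record { bound₁ = λ _ _ → z≤n ; bound₂ = λ _ _ → z≤n ; bound₃ = λ _ _ → z≤n }
separator-bounds (suc n) {A} {B} sep =
  SeparatorBounds-mono (≤-reflexive (count-vertices n A)) (≤-reflexive (count-vertices n B))
    (≤-reflexive (sym (count-vertices n (neither A B))))
    (bounds-above (length-vertices n) slices cross)
  where
    slices : Fin 3 → Slice n (length (vertices n))
    slices c = slice (size (A ∘ (c ∷_))) (size (B ∘ (c ∷_))) (size (neither A B ∘ (c ∷_)))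
                 (count-partition (disjoint sep) (vertices n)) (separator-bounds n (restrict c sep))

    cross : Cross (length-vertices n) slices
    cross c≢d = count-disjoint (λ ta tb → nonadjacent sep ta tb (adj-head _ c≢d)) (vertices n)

module _ {n : ℕ} (S : List (Vertex (Q3 n))) (u : Vertex (Q3 n)) where
  open Reachability (Q3 n) (vertices n) ∈-vertices (≡-dec _≟ᶠ_) adj?

  component unreached : Vertex (Q3 n) → Bool
  component x = ⌊ reach? S u x ⌋
  unreached x = not (component x) ∧ not ⌊ x ∈? S ⌋

  Reach⇒component : ∀ {x} → Reach (Q3 n) S u x → T (component x)
  Reach⇒component = fromWitness

  unreached-intro : ∀ {x} → ¬ Reach (Q3 n) S u x → x ∉ S → T (unreached x)
  unreached-intro {x} ¬u⇝x x∉S =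
    Equivalence.from (T-∧ {not (component x)}) (fromWitnessFalse ¬u⇝x , fromWitnessFalse x∉S)

  unreached-elim : ∀ {x} → T (unreached x) → ¬ Reach (Q3 n) S u x × x ∉ S
  unreached-elim {x} t with ¬c , ¬s ← Equivalence.to (T-∧ {not (component x)}) t =
    toWitnessFalse ¬c , toWitnessFalse ¬s

  Reach⇒unreached : ∀ {v x} → ¬ Reach (Q3 n) S u v → Reach (Q3 n) S v x → T (unreached x)
  Reach⇒unreached u↛v v⇝x = unreached-intro
    (λ u⇝x → u↛v (Reach-trans u⇝x (Reach-sym (λ {x} {y} → adj-sym x y) v⇝x))) (Reach-target∉ v⇝x)

  component-separated : Separated component unreached
  component-separated = record
    { disjoint    = λ tc tu → proj₁ (unreached-elim tu) (toWitness tc)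
    ; nonadjacent = λ tc tu x~y →
        proj₁ (unreached-elim tu) (Reach-snoc (toWitness tc) x~y (proj₂ (unreached-elim tu)))
    }

  neither⇒∈ : ∀ {x} → T (neither component unreached x) → x ∈ S
  neither⇒∈ {x} = toWitness ∘ excluded (component x) ⌊ x ∈? S ⌋
    where
      excluded : ∀ c s → T (not (c ∨ (not c ∧ not s))) → T s
      excluded true  _     ()
      excluded false true  _  = _
      excluded false false ()

theorem8 : (n : ℕ) → 3 ≤ n → (S : List (Vertex (Q3 n))) →
    IsExtraCut (Q3 n) 2 S → 6 * n ∸ 7 ≤ length S
theorem8 n _ S (_ , (u , v , u∉S , v∉S , u↛v) , large) = m≤n+o⇒m∸n≤o (6 * n) 7 (begin
  6 * n                    ≤⟨ bound₃ (separator-bounds n (component-separated S u))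
                                (larger⇒size (large u u∉S) (Reach⇒component S u))
                                (larger⇒size (large v v∉S) (Reach⇒unreached S u u↛v)) ⟩
  size (neither A B) + 7   ≤⟨ +-monoˡ-≤ 7 (size≤length (neither⇒∈ S u)) ⟩
  length S + 7             ≡⟨ +-comm (length S) 7 ⟩
  7 + length S             ∎)
  where
    open ≤-Reasoning
    A B : Vertex (Q3 n) → Bool
    A = component S u
    B = unreached S u
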